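{- Given integers $q \geq t \geq 2$, there is an integer $m_0$ such that the following holds. For every $m \geq m_0$, there is a coloring $\phi$ of the 2-element subsets of $U = \{0,1,\ldots, \lfloor (q/(t-1))^{m/4}\rfloor - 1\}$ with $q$ colors such that every subset of $U$ of size $m$ contains pairs of at least $t$ distinct colors. -}

module Defs where

open import Data.Nat using (ℕ; suc; _*_; _^_; _≤_; _<_; _∸_)
open import Data.Fin using (Fin)
import Data.Fin as F
open import Data.Fin.Subset using (Subset; _∈_)
open import Data.Product using (Σ; _×_; proj₁; proj₂)
open import Relation.Binary.PropositionalEquality using (_≡_)
open import Function.Definitions using (Injective)

-- N is the integer floor of (q/(t-1))^(m/4), i.e. N ≤ (q/(t-1))^(m/4) < N+1.
-- Since both sides are nonnegative, this is equivalent (raising to 4th power and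
-- clearing the positive denominator (t-1)^m) to the following:
IsFloorRoot : (q t m N : ℕ) → Set
IsFloorRoot q t m N =
  (N ^ 4) * ((t ∸ 1) ^ m) ≤ q ^ m × q ^ m < (suc N ^ 4) * ((t ∸ 1) ^ m)

-- A q-coloring of the 2-element subsets of Fin N: the pair {i,j} with i < j
-- receives colour φ i j (values with i ≥ j are irrelevant).
PairColoring : (N q : ℕ) → Set
PairColoring N q = Fin N → Fin N → Fin q

HasManyColors : {N q : ℕ} → PairColoring N q → Subset N → ℕ → Set
HasManyColors {N} φ S t =
  Σ (Fin t → Fin N × Fin N) λ g →
    (∀ k → (proj₁ (g k) ∈ S) × (proj₂ (g k) ∈ S) × (proj₁ (g k) F.< proj₂ (g k)))
    × Injective _≡_ _≡_ (λ k → φ (proj₁ (g k)) (proj₂ (g k)))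

module Submission where

-- Lemma 2.1, proved by the first-moment method with all probabilities replaced by exact
-- counts.
--
-- Colour the pairs of Fin N uniformly at random with q colours.  Call (S, T) a bad
-- configuration of a colouring if ∣S∣ = m, ∣T∣ ≤ a = t - 1 and every pair inside S has a
-- colour in T.  For a fixed (S, T) exactly ∣T∣^C(m,2) · q^(C(N,2) - C(m,2)) colourings make
-- it bad, so the total number of bad (colouring, S, T) triples is at most
-- Nᵐ · 2^q · a^C(m,2) · q^(C(N,2) - C(m,2)).  When N⁴aᵐ ≤ qᵐ and m is large this is less than
-- the number q^C(N,2) of colourings, so some colouring has no bad configuration; in it the
-- colours used inside any m-set S form a set of size > a, from which t pairs of distinct
-- colours are picked.

open import Defs
open import Data.Nat
open import Data.Nat.Properties
open import Data.Nat.Tactic.RingSolver using (solve-∀)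
open import Data.Bool using (Bool; true; false; T)
open import Data.Empty using (⊥-elim)
open import Data.Unit using (⊤; tt)
open import Data.Product using (Σ; ∃; _,_; proj₁; proj₂; _×_; uncurry)
open import Data.Fin using (Fin; zero; suc)
import Data.Fin as F
import Data.Fin.Properties as FinP
open import Data.Fin.Subset using (Subset; ∣_∣; ∁; inside; outside; _∈_)
open import Data.Fin.Subset.Properties using (_∈?_; ∣∁p∣≡n∸∣p∣; ∣p∣≤n)
open import Data.Vec using (Vec; []; _∷_; lookup; tabulate; here; there)
open import Data.Vec.Properties using ([]=⇒lookup; lookup⇒[]=; lookup∘tabulate)
open import Data.List using (List; []; _∷_; _++_; map; length; allFin; cartesianProduct)
open import Data.List.Properties using (map-tabulate; length-tabulate)
open import Data.List.Membership.Propositional using () renaming (_∈_ to _∈ₗ_)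
open import Data.List.Membership.Propositional.Properties using (∈-map⁺; ∈-cartesianProduct⁺)
open import Data.List.Relation.Unary.Any using (here; there)
open import Function using (_∘_; id)
open import Function.Definitions using (Injective)
open import Relation.Binary.PropositionalEquality
open import Relation.Nullary using (Dec; does; yes; no; ¬_)
open import Relation.Nullary.Decidable using (_×-dec_; dec-true; toWitness; isYes≗does)
open import Algebra.Properties.CommutativeSemigroup *-commutativeSemigroup
  using () renaming (interchange to *-interchange; x∙yz≈y∙xz to *-left-comm)
open import Algebra.Properties.CommutativeSemigroup +-commutativeSemigroup
  using () renaming (interchange to +-interchange; x∙yz≈y∙xz to +-left-comm)

private variable
  A B : Set

sumOver : List A → (A → ℕ) → ℕ
sumOver []       f = 0
sumOver (x ∷ xs) f = f x + sumOver xs f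

infix 5 sumOver
syntax sumOver xs (λ x → e) = ∑[ x ∈ xs ] e

∑-cong : (xs : List A) {f g : A → ℕ} → (∀ x → f x ≡ g x) → sumOver xs f ≡ sumOver xs g
∑-cong []       f≗g = refl
∑-cong (x ∷ xs) f≗g = cong₂ _+_ (f≗g x) (∑-cong xs f≗g)

∑-mono : (xs : List A) {f g : A → ℕ} → (∀ x → f x ≤ g x) → sumOver xs f ≤ sumOver xs g
∑-mono []       f≤g = z≤n
∑-mono (x ∷ xs) f≤g = +-mono-≤ (f≤g x) (∑-mono xs f≤g)

∑-zero : (xs : List A) → ∑[ x ∈ xs ] 0 ≡ 0
∑-zero []       = refl
∑-zero (x ∷ xs) = ∑-zero xs

∑-+ : (xs : List A) (f g : A → ℕ) → ∑[ x ∈ xs ] (f x + g x) ≡ sumOver xs f + sumOver xs g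
∑-+ []       f g = refl
∑-+ (x ∷ xs) f g = trans (cong ((f x + g x) +_) (∑-+ xs f g))
                         (+-interchange (f x) (g x) (sumOver xs f) (sumOver xs g))

∑-*ˡ : (xs : List A) (k : ℕ) (f : A → ℕ) → ∑[ x ∈ xs ] (k * f x) ≡ k * sumOver xs f
∑-*ˡ []       k f = sym (*-zeroʳ k)
∑-*ˡ (x ∷ xs) k f = trans (cong (k * f x +_) (∑-*ˡ xs k f)) (sym (*-distribˡ-+ k (f x) (sumOver xs f)))

∑-1 : (xs : List A) → ∑[ x ∈ xs ] 1 ≡ length xs
∑-1 []       = refl
∑-1 (x ∷ xs) = cong suc (∑-1 xs)

∑-const : (xs : List A) (k : ℕ) → ∑[ x ∈ xs ] k ≡ k * (∑[ x ∈ xs ] 1)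
∑-const xs k = trans (∑-cong xs (λ _ → sym (*-identityʳ k))) (∑-*ˡ xs k (λ _ → 1))

∑-swap : (xs : List A) (ys : List B) (h : A → B → ℕ) →
  ∑[ x ∈ xs ] ∑[ y ∈ ys ] h x y ≡ ∑[ y ∈ ys ] ∑[ x ∈ xs ] h x y
∑-swap []       ys h = sym (∑-zero ys)
∑-swap (x ∷ xs) ys h = trans (cong (sumOver ys (h x) +_) (∑-swap xs ys h))
                             (sym (∑-+ ys (h x) (λ y → ∑[ x ∈ xs ] h x y)))

∑-++ : (xs ys : List A) (f : A → ℕ) → sumOver (xs ++ ys) f ≡ sumOver xs f + sumOver ys f
∑-++ []       ys f = refl
∑-++ (x ∷ xs) ys f = trans (cong (f x +_) (∑-++ xs ys f)) (sym (+-assoc (f x) _ _))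

∑-map : (xs : List A) (g : A → B) (f : B → ℕ) → sumOver (map g xs) f ≡ ∑[ x ∈ xs ] f (g x)
∑-map []       g f = refl
∑-map (x ∷ xs) g f = cong (f (g x) +_) (∑-map xs g f)

∑-cartesianProduct : (xs : List A) (ys : List B) (h : A × B → ℕ) →
  sumOver (cartesianProduct xs ys) h ≡ ∑[ x ∈ xs ] ∑[ y ∈ ys ] h (x , y)
∑-cartesianProduct []       ys h = refl
∑-cartesianProduct (x ∷ xs) ys h = begin
  sumOver (map (x ,_) ys ++ cartesianProduct xs ys) h
    ≡⟨ ∑-++ (map (x ,_) ys) _ h ⟩
  sumOver (map (x ,_) ys) h + sumOver (cartesianProduct xs ys) h
    ≡⟨ cong₂ _+_ (∑-map ys (x ,_) h) (∑-cartesianProduct xs ys h) ⟩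
  (∑[ y ∈ ys ] h (x , y)) + (∑[ x ∈ xs ] ∑[ y ∈ ys ] h (x , y)) ∎
  where open ≡-Reasoning

∑-factorise : (xs : List A) (ys : List B) {h : A × B → ℕ} (f : A → ℕ) (g : B → ℕ) →
  (∀ x y → h (x , y) ≡ f x * g y) →
  sumOver (cartesianProduct xs ys) h ≡ sumOver xs f * sumOver ys g
∑-factorise xs ys {h} f g h≡fg = begin
  sumOver (cartesianProduct xs ys) h  ≡⟨ ∑-cartesianProduct xs ys h ⟩
  (∑[ x ∈ xs ] ∑[ y ∈ ys ] h (x , y)) ≡⟨ ∑-cong xs (λ x → ∑-cong ys (h≡fg x)) ⟩
  (∑[ x ∈ xs ] ∑[ y ∈ ys ] f x * g y) ≡⟨ ∑-cong xs (λ x → ∑-*ˡ ys (f x) g) ⟩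
  (∑[ x ∈ xs ] f x * sumOver ys g)    ≡⟨ ∑-cong xs (λ x → *-comm (f x) _) ⟩
  (∑[ x ∈ xs ] sumOver ys g * f x)    ≡⟨ ∑-*ˡ xs (sumOver ys g) f ⟩
  sumOver ys g * sumOver xs f         ≡⟨ *-comm (sumOver ys g) _ ⟩
  sumOver xs f * sumOver ys g         ∎
  where open ≡-Reasoning

∑-member : {xs : List A} (f : A → ℕ) {x : A} → x ∈ₗ xs → f x ≤ sumOver xs f
∑-member f (here refl) = m≤m+n _ _
∑-member f (there x∈)  = ≤-trans (∑-member f x∈) (m≤n+m _ _)

∑-<-witness : (xs : List A) (f g : A → ℕ) → sumOver xs f < sumOver xs g → ∃ λ x → f x < g x
∑-<-witness []       f g ()
∑-<-witness (x ∷ xs) f g ∑f<∑g with f x <? g x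
... | yes fx<gx = x , fx<gx
... | no  fx≮gx = ∑-<-witness xs f g
  (+-cancelˡ-< (g x) _ _ (≤-<-trans (+-monoˡ-≤ (sumOver xs f) (≮⇒≥ fx≮gx)) ∑f<∑g))

vectors : List A → (n : ℕ) → List (Vec A n)
vectors xs zero    = [] ∷ []
vectors xs (suc n) = map (uncurry _∷_) (cartesianProduct xs (vectors xs n))

∑-vectors-suc : (xs : List A) (n : ℕ) (h : Vec A (suc n) → ℕ) →
  sumOver (vectors xs (suc n)) h ≡ ∑[ x ∈ xs ] ∑[ v ∈ vectors xs n ] h (x ∷ v)
∑-vectors-suc xs n h =
  trans (∑-map (cartesianProduct xs (vectors xs n)) (uncurry _∷_) h)
        (∑-cartesianProduct xs (vectors xs n) (h ∘ uncurry _∷_))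

∑-vectors-factorise : (xs : List A) (n : ℕ) {h : Vec A (suc n) → ℕ} (f : A → ℕ) (g : Vec A n → ℕ) →
  (∀ x v → h (x ∷ v) ≡ f x * g v) →
  sumOver (vectors xs (suc n)) h ≡ sumOver xs f * sumOver (vectors xs n) g
∑-vectors-factorise xs n {h} f g h≡fg =
  trans (∑-map (cartesianProduct xs (vectors xs n)) (uncurry _∷_) h)
        (∑-factorise xs (vectors xs n) f g h≡fg)

#vectors : (xs : List A) (n : ℕ) → ∑[ v ∈ vectors xs n ] 1 ≡ length xs ^ n
#vectors xs zero    = refl
#vectors xs (suc n) = begin
  ∑[ v ∈ vectors xs (suc n) ] 1                       ≡⟨ ∑-vectors-factorise xs n (λ _ → 1) (λ _ → 1) (λ _ _ → refl) ⟩
  (∑[ x ∈ xs ] 1) * (∑[ v ∈ vectors xs n ] 1)         ≡⟨ cong₂ _*_ (∑-1 xs) (#vectors xs n) ⟩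
  length xs * length xs ^ n                          ∎
  where open ≡-Reasoning

vectors-complete : {xs : List A} → (∀ a → a ∈ₗ xs) → {n : ℕ} (v : Vec A n) → v ∈ₗ vectors xs n
vectors-complete all∈ []      = here refl
vectors-complete all∈ (x ∷ v) = ∈-map⁺ (uncurry _∷_) (∈-cartesianProduct⁺ (all∈ x) (vectors-complete all∈ v))

sides : List Bool
sides = inside ∷ outside ∷ []

subsets : (n : ℕ) → List (Subset n)
subsets = vectors sides

subsets-complete : {n : ℕ} (S : Subset n) → S ∈ₗ subsets n
subsets-complete = vectors-complete λ { inside → here refl ; outside → there (here refl) }

∑-subsets-suc : (n : ℕ) (f : Subset (suc n) → ℕ) →
  sumOver (subsets (suc n)) f ≡ (∑[ S ∈ subsets n ] f (inside ∷ S)) + (∑[ S ∈ subsets n ] f (outside ∷ S))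
∑-subsets-suc n f = trans (∑-vectors-suc sides n f) (cong ((∑[ S ∈ subsets n ] f (inside ∷ S)) +_) (+-identityʳ _))

𝟙 : Bool → ℕ
𝟙 true  = 1
𝟙 false = 0

𝟙-guard : (b : Bool) {x y : ℕ} → (T b → x ≤ y) → 𝟙 b * x ≤ 𝟙 b * y
𝟙-guard true  x≤y = *-monoʳ-≤ 1 (x≤y _)
𝟙-guard false x≤y = z≤n

𝟙-true : {b : Bool} → T b → 𝟙 b ≡ 1
𝟙-true {true} _ = refl

𝟙-≤ : (b : Bool) (x : ℕ) → 𝟙 b * x ≤ x
𝟙-≤ true  x = ≤-reflexive (*-identityˡ x)
𝟙-≤ false x = z≤n

#subsets-of-size : (N m : ℕ) → ∑[ S ∈ subsets N ] 𝟙 (∣ S ∣ ≡ᵇ m) ≤ N ^ m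
#subsets-of-size zero    zero    = ≤-refl
#subsets-of-size zero    (suc m) = ≤-refl
#subsets-of-size (suc N) zero    = begin
  ∑[ S ∈ subsets (suc N) ] 𝟙 (∣ S ∣ ≡ᵇ 0)  ≡⟨ ∑-subsets-suc N _ ⟩
  (∑[ S ∈ subsets N ] 0) + (∑[ S ∈ subsets N ] 𝟙 (∣ S ∣ ≡ᵇ 0))
    ≡⟨ cong (_+ (∑[ S ∈ subsets N ] 𝟙 (∣ S ∣ ≡ᵇ 0))) (∑-zero (subsets N)) ⟩
  (∑[ S ∈ subsets N ] 𝟙 (∣ S ∣ ≡ᵇ 0))  ≤⟨ #subsets-of-size N zero ⟩
  1 ∎
  where open ≤-Reasoning
#subsets-of-size (suc N) (suc m) = begin
  ∑[ S ∈ subsets (suc N) ] 𝟙 (∣ S ∣ ≡ᵇ suc m)  ≡⟨ ∑-subsets-suc N _ ⟩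
  (∑[ S ∈ subsets N ] 𝟙 (∣ S ∣ ≡ᵇ m)) + (∑[ S ∈ subsets N ] 𝟙 (∣ S ∣ ≡ᵇ suc m))
    ≤⟨ +-mono-≤ (#subsets-of-size N m) (#subsets-of-size N (suc m)) ⟩
  suc N * N ^ m  ≤⟨ *-monoʳ-≤ (suc N) (^-monoˡ-≤ m (n≤1+n N)) ⟩
  suc N ^ suc m ∎
  where open ≤-Reasoning

∑-allFin-suc : (n : ℕ) (f : Fin (suc n) → ℕ) →
  sumOver (allFin (suc n)) f ≡ f zero + (∑[ i ∈ allFin n ] f (suc i))
∑-allFin-suc n f = cong (f zero +_)
  (trans (cong (λ is → sumOver is f) (sym (map-tabulate id suc))) (∑-map (allFin n) suc f))

length-allFin : (n : ℕ) → length (allFin n) ≡ n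
length-allFin n = length-tabulate id

∑-membership : {n : ℕ} (T : Subset n) → ∑[ x ∈ allFin n ] 𝟙 (lookup T x) ≡ ∣ T ∣
∑-membership []            = refl
∑-membership {suc n} T@(inside  ∷ T′) = trans (∑-allFin-suc n (𝟙 ∘ lookup T)) (cong suc (∑-membership T′))
∑-membership {suc n} T@(outside ∷ T′) = trans (∑-allFin-suc n (𝟙 ∘ lookup T)) (∑-membership T′)

-- pairs n = n(n-1)/2, the number of 2-element subsets of an n-element set.
pairs : ℕ → ℕ
pairs zero    = 0
pairs (suc n) = n + pairs n

∣S∣+∣∁S∣≡n : {n : ℕ} (S : Subset n) → ∣ S ∣ + ∣ ∁ S ∣ ≡ n
∣S∣+∣∁S∣≡n S = trans (cong (∣ S ∣ +_) (∣∁p∣≡n∸∣p∣ S)) (m+[n∸m]≡n (∣p∣≤n S))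

-- For S ⊆ Fin N, the 2-subsets of Fin N split into those inside S and the others.
innerPairs : {N : ℕ} → Subset N → ℕ
innerPairs []            = 0
innerPairs (inside  ∷ S) = ∣ S ∣ + innerPairs S
innerPairs (outside ∷ S) = innerPairs S

outerPairs : {N : ℕ} → Subset N → ℕ
outerPairs []                    = 0
outerPairs (inside  ∷ S)         = ∣ ∁ S ∣ + outerPairs S
outerPairs {suc N} (outside ∷ S) = N + outerPairs S

innerPairs≡pairs : {N : ℕ} (S : Subset N) → innerPairs S ≡ pairs ∣ S ∣
innerPairs≡pairs []            = refl
innerPairs≡pairs (inside  ∷ S) = cong (∣ S ∣ +_) (innerPairs≡pairs S)
innerPairs≡pairs (outside ∷ S) = innerPairs≡pairs S

inner+outer≡pairs : {N : ℕ} (S : Subset N) → innerPairs S + outerPairs S ≡ pairs N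
inner+outer≡pairs []            = refl
inner+outer≡pairs {suc N} (inside  ∷ S) = begin
  (∣ S ∣ + innerPairs S) + (∣ ∁ S ∣ + outerPairs S) ≡⟨ +-interchange (∣ S ∣) (innerPairs S) (∣ ∁ S ∣) (outerPairs S) ⟩
  (∣ S ∣ + ∣ ∁ S ∣) + (innerPairs S + outerPairs S) ≡⟨ cong₂ _+_ (∣S∣+∣∁S∣≡n S) (inner+outer≡pairs S) ⟩
  N + pairs N ∎
  where open ≡-Reasoning
inner+outer≡pairs {suc N} (outside ∷ S) =
  trans (+-left-comm (innerPairs S) N (outerPairs S)) (cong (N +_) (inner+outer≡pairs S))

^-interchange : ∀ a b x y z w → (a ^ x * b ^ y) * (a ^ z * b ^ w) ≡ a ^ (x + z) * b ^ (y + w)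
^-interchange a b x y z w = trans (*-interchange (a ^ x) (b ^ y) (a ^ z) (b ^ w))
  (sym (cong₂ _*_ (^-distribˡ-+-* a x z) (^-distribˡ-+-* b y w)))

module Colourings (q : ℕ) where

  -- A colouring of the pairs of Fin (suc N) is stored as a row giving the colours of
  -- the pairs {0, v+1}, followed by a colouring of the pairs of the remaining N points.
  Row : ℕ → Set
  Row n = Vec (Fin q) n

  rows : (n : ℕ) → List (Row n)
  rows = vectors (allFin q)

  TriColouring : ℕ → Set
  TriColouring zero    = ⊤
  TriColouring (suc N) = Row N × TriColouring N

  colourings : (N : ℕ) → List (TriColouring N)
  colourings zero    = tt ∷ []
  colourings (suc N) = cartesianProduct (rows N) (colourings N)

  ∑-allFin-1 : ∑[ x ∈ allFin q ] 1 ≡ q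
  ∑-allFin-1 = trans (∑-1 (allFin q)) (length-allFin q)

  #rows : (n : ℕ) → ∑[ r ∈ rows n ] 1 ≡ q ^ n
  #rows n = trans (#vectors (allFin q) n) (cong (_^ n) (length-allFin q))

  #colourings : (N : ℕ) → ∑[ c ∈ colourings N ] 1 ≡ q ^ pairs N
  #colourings zero    = refl
  #colourings (suc N) = begin
    ∑[ c ∈ colourings (suc N) ] 1 ≡⟨ ∑-factorise (rows N) (colourings N) (λ _ → 1) (λ _ → 1) (λ _ _ → refl) ⟩
    (∑[ r ∈ rows N ] 1) * (∑[ c ∈ colourings N ] 1) ≡⟨ cong₂ _*_ (#rows N) (#colourings N) ⟩
    q ^ N * q ^ pairs N ≡⟨ sym (^-distribˡ-+-* q N (pairs N)) ⟩
    q ^ (N + pairs N) ∎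
    where open ≡-Reasoning

  -- The pair colouring encoded by a triangular colouring; d fills the unused entries.
  decode : Fin q → {N : ℕ} → TriColouring N → PairColoring N q
  decode d {suc N} (r , c) zero    (suc v) = lookup r v
  decode d {suc N} (r , c) (suc u) (suc v) = decode d c u v
  decode d _ _ _ = d

  rowConfined : {n : ℕ} → Subset n → Subset q → Row n → ℕ
  rowConfined []            T []      = 1
  rowConfined (inside  ∷ S) T (x ∷ r) = 𝟙 (lookup T x) * rowConfined S T r
  rowConfined (outside ∷ S) T (x ∷ r) = rowConfined S T r

  confined : {N : ℕ} → Subset N → Subset q → TriColouring N → ℕ
  confined []            T tt      = 1
  confined (inside  ∷ S) T (r , c) = rowConfined S T r * confined S T c
  confined (outside ∷ S) T (r , c) = confined S T c

  -- Counting rows: the entries in S have ∣T∣ choices each, the others q.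
  #rowConfined : {n : ℕ} (S : Subset n) (T : Subset q) →
    ∑[ r ∈ rows n ] rowConfined S T r ≡ ∣ T ∣ ^ ∣ S ∣ * q ^ ∣ ∁ S ∣
  #rowConfined []            T = refl
  #rowConfined {suc n} (inside ∷ S) T = begin
    ∑[ r ∈ rows (suc n) ] rowConfined (inside ∷ S) T r
      ≡⟨ ∑-vectors-factorise (allFin q) n (𝟙 ∘ lookup T) (rowConfined S T) (λ _ _ → refl) ⟩
    (∑[ x ∈ allFin q ] 𝟙 (lookup T x)) * (∑[ r ∈ rows n ] rowConfined S T r)
      ≡⟨ cong₂ _*_ (∑-membership T) (#rowConfined S T) ⟩
    ∣ T ∣ * (∣ T ∣ ^ ∣ S ∣ * q ^ ∣ ∁ S ∣) ≡⟨ sym (*-assoc ∣ T ∣ (∣ T ∣ ^ ∣ S ∣) (q ^ ∣ ∁ S ∣)) ⟩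
    ∣ T ∣ ^ suc ∣ S ∣ * q ^ ∣ ∁ S ∣ ∎
    where open ≡-Reasoning
  #rowConfined {suc n} (outside ∷ S) T = begin
    ∑[ r ∈ rows (suc n) ] rowConfined (outside ∷ S) T r
      ≡⟨ ∑-vectors-factorise (allFin q) n (λ _ → 1) (rowConfined S T) (λ _ _ → sym (*-identityˡ _)) ⟩
    (∑[ x ∈ allFin q ] 1) * (∑[ r ∈ rows n ] rowConfined S T r)
      ≡⟨ cong₂ _*_ ∑-allFin-1 (#rowConfined S T) ⟩
    q * (∣ T ∣ ^ ∣ S ∣ * q ^ ∣ ∁ S ∣) ≡⟨ *-left-comm q (∣ T ∣ ^ ∣ S ∣) (q ^ ∣ ∁ S ∣) ⟩
    ∣ T ∣ ^ ∣ S ∣ * q ^ suc ∣ ∁ S ∣ ∎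
    where open ≡-Reasoning

  -- Counting: the pairs inside S have ∣T∣ choices each, the others q.
  #confined : {N : ℕ} (S : Subset N) (T : Subset q) →
    ∑[ c ∈ colourings N ] confined S T c ≡ ∣ T ∣ ^ innerPairs S * q ^ outerPairs S
  #confined []            T = refl
  #confined {suc N} (inside ∷ S) T = begin
    ∑[ c ∈ colourings (suc N) ] confined (inside ∷ S) T c
      ≡⟨ ∑-factorise (rows N) (colourings N) (rowConfined S T) (confined S T) (λ _ _ → refl) ⟩
    (∑[ r ∈ rows N ] rowConfined S T r) * (∑[ c ∈ colourings N ] confined S T c)
      ≡⟨ cong₂ _*_ (#rowConfined S T) (#confined S T) ⟩
    (∣ T ∣ ^ ∣ S ∣ * q ^ ∣ ∁ S ∣) * (∣ T ∣ ^ innerPairs S * q ^ outerPairs S)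
      ≡⟨ ^-interchange ∣ T ∣ q (∣ S ∣) (∣ ∁ S ∣) (innerPairs S) (outerPairs S) ⟩
    ∣ T ∣ ^ (∣ S ∣ + innerPairs S) * q ^ (∣ ∁ S ∣ + outerPairs S) ∎
    where open ≡-Reasoning
  #confined {suc N} (outside ∷ S) T = begin
    ∑[ c ∈ colourings (suc N) ] confined (outside ∷ S) T c
      ≡⟨ ∑-factorise (rows N) (colourings N) (λ _ → 1) (confined S T) (λ _ _ → sym (*-identityˡ _)) ⟩
    (∑[ r ∈ rows N ] 1) * (∑[ c ∈ colourings N ] confined S T c)
      ≡⟨ cong₂ _*_ (#rows N) (#confined S T) ⟩
    q ^ N * (∣ T ∣ ^ innerPairs S * q ^ outerPairs S)
      ≡⟨ *-left-comm (q ^ N) (∣ T ∣ ^ innerPairs S) (q ^ outerPairs S) ⟩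
    ∣ T ∣ ^ innerPairs S * (q ^ N * q ^ outerPairs S)
      ≡⟨ cong (∣ T ∣ ^ innerPairs S *_) (sym (^-distribˡ-+-* q N (outerPairs S))) ⟩
    ∣ T ∣ ^ innerPairs S * q ^ (N + outerPairs S) ∎
    where open ≡-Reasoning

  -- Rescaled by the colourings of the inner pairs, the count no longer depends on the
  -- position of S in Fin N.
  #confined-scaled : {N : ℕ} (S : Subset N) (T : Subset q) →
    q ^ innerPairs S * (∑[ c ∈ colourings N ] confined S T c) ≡ ∣ T ∣ ^ innerPairs S * q ^ pairs N
  #confined-scaled {N} S T = begin
    q ^ innerPairs S * (∑[ c ∈ colourings N ] confined S T c)
      ≡⟨ cong (q ^ innerPairs S *_) (#confined S T) ⟩
    q ^ innerPairs S * (∣ T ∣ ^ innerPairs S * q ^ outerPairs S)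
      ≡⟨ *-left-comm (q ^ innerPairs S) (∣ T ∣ ^ innerPairs S) (q ^ outerPairs S) ⟩
    ∣ T ∣ ^ innerPairs S * (q ^ innerPairs S * q ^ outerPairs S)
      ≡⟨ cong (∣ T ∣ ^ innerPairs S *_) (sym (^-distribˡ-+-* q (innerPairs S) (outerPairs S))) ⟩
    ∣ T ∣ ^ innerPairs S * q ^ (innerPairs S + outerPairs S)
      ≡⟨ cong (λ e → ∣ T ∣ ^ innerPairs S * q ^ e) (inner+outer≡pairs S) ⟩
    ∣ T ∣ ^ innerPairs S * q ^ pairs N ∎
    where open ≡-Reasoning

  rowConfined-all : {n : ℕ} (S : Subset n) (T : Subset q) (r : Row n) →
    (∀ v → v ∈ S → lookup r v ∈ T) → rowConfined S T r ≡ 1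
  rowConfined-all []            T []      all∈ = refl
  rowConfined-all (inside  ∷ S) T (x ∷ r) all∈ rewrite []=⇒lookup (all∈ zero here) =
    trans (+-identityʳ _) (rowConfined-all S T r (λ v v∈S → all∈ (suc v) (there v∈S)))
  rowConfined-all (outside ∷ S) T (x ∷ r) all∈ =
    rowConfined-all S T r (λ v v∈S → all∈ (suc v) (there v∈S))

  decode-confined : (d : Fin q) {N : ℕ} (S : Subset N) (T : Subset q) (c : TriColouring N) →
    (∀ u v → u ∈ S → v ∈ S → u F.< v → decode d c u v ∈ T) → confined S T c ≡ 1
  decode-confined d []            T tt      all∈ = refl
  decode-confined d (inside  ∷ S) T (r , c) all∈ = cong₂ _*_
    (rowConfined-all S T r (λ v v∈S → all∈ zero (suc v) here (there v∈S) (s≤s z≤n)))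
    (decode-confined d S T c (λ u v u∈S v∈S u<v → all∈ (suc u) (suc v) (there u∈S) (there v∈S) (s≤s u<v)))
  decode-confined d (outside ∷ S) T (r , c) all∈ =
    decode-confined d S T c (λ u v u∈S v∈S u<v → all∈ (suc u) (suc v) (there u∈S) (there v∈S) (s≤s u<v))

*-^-distrib : ∀ x y n → (x * y) ^ n ≡ x ^ n * y ^ n
*-^-distrib x y zero    = refl
*-^-distrib x y (suc n) = trans (cong (x * y *_) (*-^-distrib x y n)) (rearrange x y (x ^ n) (y ^ n))
  where
  rearrange : ∀ x y u v → x * y * (u * v) ≡ x * u * (y * v)
  rearrange = solve-∀

^-cancelˡ-< : ∀ n {x y} → x ^ n < y ^ n → x < y
^-cancelˡ-< n {x} {y} xⁿ<yⁿ with x <? y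
... | yes x<y = x<y
... | no  x≮y = ⊥-elim (<⇒≱ xⁿ<yⁿ (^-monoˡ-≤ n (≮⇒≥ x≮y)))

-- A form of Bernoulli's inequality: (a+1)ⁿ⁺¹ ≥ aⁿ⁺¹ + (n+1)aⁿ.
bernoulli : ∀ a n → a ^ n * suc (a + n) ≤ suc a ^ suc n
bernoulli a zero    = ≤-reflexive (base a)
  where
  base : ∀ a → 1 * suc (a + 0) ≡ suc a * 1
  base = solve-∀
bernoulli a (suc n) = begin
  a ^ suc n * suc (a + suc n)                  ≤⟨ m≤m+n _ _ ⟩
  a ^ suc n * suc (a + suc n) + a ^ n * suc n  ≡⟨ rearrange a n (a ^ n) ⟩
  suc a * (a ^ n * suc (a + n))                ≤⟨ *-monoʳ-≤ (suc a) (bernoulli a n) ⟩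
  suc a * suc a ^ suc n                        ∎
  where
  open ≤-Reasoning
  rearrange : ∀ a n x → a * x * suc (a + suc n) + x * suc n ≡ suc a * (x * suc (a + n))
  rearrange = solve-∀

-- (1 + 1/a)ᵃ ≥ 2 for a ≥ 1, cleared of denominators.
doubling : ∀ b → 2 * suc b ^ suc b ≤ suc (suc b) ^ suc b
doubling b = begin
  2 * suc b ^ suc b             ≡⟨ rearrange b (suc b ^ b) ⟩
  suc b ^ b * suc (suc b + b)   ≤⟨ bernoulli (suc b) b ⟩
  suc (suc b) ^ suc b           ∎
  where
  open ≤-Reasoning
  rearrange : ∀ b x → 2 * (suc b * x) ≡ x * suc (suc b + b)
  rearrange = solve-∀

exponential-gap : ∀ b Q k → suc b * suc Q ≤ k → 2 ^ Q * suc b ^ k < suc (suc b) ^ k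
exponential-gap b Q k aQ≤k with m≤n⇒∃[o]m+o≡n aQ≤k
... | r , refl = begin-strict
  2 ^ Q * a ^ (k₀ + r)             <⟨ *-monoˡ-< (a ^ (k₀ + r)) {{>-nonZero (m^n>0 a (k₀ + r))}}
                                       (^-monoʳ-< 2 (s≤s (s≤s z≤n)) (n<1+n Q)) ⟩
  2 ^ suc Q * a ^ (k₀ + r)         ≡⟨ cong (2 ^ suc Q *_) (^-distribˡ-+-* a k₀ r) ⟩
  2 ^ suc Q * (a ^ k₀ * a ^ r)     ≡⟨ sym (*-assoc (2 ^ suc Q) (a ^ k₀) (a ^ r)) ⟩
  2 ^ suc Q * a ^ k₀ * a ^ r       ≤⟨ *-mono-≤ doubled (^-monoˡ-≤ r (n≤1+n a)) ⟩
  suc a ^ k₀ * suc a ^ r           ≡⟨ sym (^-distribˡ-+-* (suc a) k₀ r) ⟩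
  suc a ^ (k₀ + r)                 ∎
  where
  open ≤-Reasoning
  a = suc b
  k₀ = a * suc Q
  doubled : 2 ^ suc Q * a ^ k₀ ≤ suc a ^ k₀
  doubled = begin
    2 ^ suc Q * a ^ (a * suc Q)   ≡⟨ cong (2 ^ suc Q *_) (sym (^-*-assoc a a (suc Q))) ⟩
    2 ^ suc Q * (a ^ a) ^ suc Q   ≡⟨ sym (*-^-distrib 2 (a ^ a) (suc Q)) ⟩
    (2 * a ^ a) ^ suc Q           ≤⟨ ^-monoˡ-≤ (suc Q) (doubling b) ⟩
    (suc a ^ a) ^ suc Q           ≡⟨ ^-*-assoc (suc a) a (suc Q) ⟩
    suc a ^ (a * suc Q)           ∎

pairs-times-4 : ∀ j → pairs (2 + j) * 4 ≡ (2 + j) * (2 + j) + (2 + j) * j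
pairs-times-4 zero    = refl
pairs-times-4 (suc j) = begin
  (2 + j + pairs (2 + j)) * 4                  ≡⟨ *-distribʳ-+ 4 (2 + j) (pairs (2 + j)) ⟩
  (2 + j) * 4 + pairs (2 + j) * 4              ≡⟨ cong ((2 + j) * 4 +_) (pairs-times-4 j) ⟩
  (2 + j) * 4 + ((2 + j) * (2 + j) + (2 + j) * j) ≡⟨ rearrange j ⟩
  (3 + j) * (3 + j) + (3 + j) * suc j          ∎
  where
  open ≡-Reasoning
  rearrange : ∀ j → (2 + j) * 4 + ((2 + j) * (2 + j) + (2 + j) * j) ≡ (3 + j) * (3 + j) + (3 + j) * suc j
  rearrange = solve-∀

pow-pairs⁴ : ∀ x j → (x ^ pairs (2 + j)) ^ 4 ≡ (x ^ (2 + j)) ^ (2 + j) * x ^ ((2 + j) * j)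
pow-pairs⁴ x j = begin
  (x ^ pairs m) ^ 4            ≡⟨ ^-*-assoc x (pairs m) 4 ⟩
  x ^ (pairs m * 4)            ≡⟨ cong (x ^_) (pairs-times-4 j) ⟩
  x ^ (m * m + m * j)          ≡⟨ ^-distribˡ-+-* x (m * m) (m * j) ⟩
  x ^ (m * m) * x ^ (m * j)    ≡⟨ cong (_* x ^ (m * j)) (sym (^-*-assoc x m m)) ⟩
  (x ^ m) ^ m * x ^ (m * j)    ∎
  where
  open ≡-Reasoning
  m = 2 + j

expand⁴ : ∀ N y a j → let m = 2 + j in
  (N ^ m * y * a ^ pairs m) ^ 4 ≡ (N ^ 4 * a ^ m) ^ m * (y ^ 4 * a ^ (m * j))
expand⁴ N y a j = begin
  (N ^ m * y * a ^ E) ^ 4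
    ≡⟨ trans (*-^-distrib (N ^ m * y) (a ^ E) 4) (cong (_* (a ^ E) ^ 4) (*-^-distrib (N ^ m) y 4)) ⟩
  (N ^ m) ^ 4 * y ^ 4 * (a ^ E) ^ 4
    ≡⟨ cong₂ (λ u v → u * y ^ 4 * v) Nᵐ⁴≡N⁴ᵐ (pow-pairs⁴ a j) ⟩
  (N ^ 4) ^ m * y ^ 4 * ((a ^ m) ^ m * a ^ (m * j))
    ≡⟨ rearrange ((N ^ 4) ^ m) (y ^ 4) ((a ^ m) ^ m) (a ^ (m * j)) ⟩
  ((N ^ 4) ^ m * (a ^ m) ^ m) * (y ^ 4 * a ^ (m * j))
    ≡⟨ cong (_* (y ^ 4 * a ^ (m * j))) (sym (*-^-distrib (N ^ 4) (a ^ m) m)) ⟩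
  (N ^ 4 * a ^ m) ^ m * (y ^ 4 * a ^ (m * j)) ∎
  where
  open ≡-Reasoning
  m = 2 + j
  E = pairs m
  Nᵐ⁴≡N⁴ᵐ : (N ^ m) ^ 4 ≡ (N ^ 4) ^ m
  Nᵐ⁴≡N⁴ᵐ = trans (^-*-assoc N m 4) (trans (cong (N ^_) (*-comm m 4)) (sym (^-*-assoc N 4 m)))
  rearrange : ∀ P Y R S → P * Y * (R * S) ≡ (P * R) * (Y * S)
  rearrange = solve-∀

key-inequality : ∀ N b q j → let m = 2 + j ; a = suc b in
  N ^ 4 * a ^ m ≤ q ^ m → suc a ≤ q → a * suc (q * 4) ≤ j →
  N ^ m * 2 ^ q * a ^ pairs m < q ^ pairs m
key-inequality N b q j N⁴aᵐ≤qᵐ a<q a[4q+1]≤j = ^-cancelˡ-< 4 (begin-strict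
  (N ^ m * 2 ^ q * a ^ pairs m) ^ 4
    ≡⟨ expand⁴ N (2 ^ q) a j ⟩
  (N ^ 4 * a ^ m) ^ m * ((2 ^ q) ^ 4 * a ^ (m * j))
    ≤⟨ *-monoˡ-≤ ((2 ^ q) ^ 4 * a ^ (m * j)) (^-monoˡ-≤ m N⁴aᵐ≤qᵐ) ⟩
  (q ^ m) ^ m * ((2 ^ q) ^ 4 * a ^ (m * j))
    <⟨ *-monoʳ-< ((q ^ m) ^ m) {{>-nonZero (m^n>0 (q ^ m) {{qᵐ≢0}} m)}} gap ⟩
  (q ^ m) ^ m * q ^ (m * j)
    ≡⟨ sym (pow-pairs⁴ q j) ⟩
  (q ^ pairs m) ^ 4 ∎)
  where
  open ≤-Reasoning
  m = 2 + j
  a = suc b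
  qᵐ≢0 : NonZero (q ^ m)
  qᵐ≢0 = >-nonZero (<-≤-trans (m^n>0 (suc a) m) (^-monoˡ-≤ m a<q))
  gap : (2 ^ q) ^ 4 * a ^ (m * j) < q ^ (m * j)
  gap = begin-strict
    (2 ^ q) ^ 4 * a ^ (m * j)  ≡⟨ cong (_* a ^ (m * j)) (^-*-assoc 2 q 4) ⟩
    2 ^ (q * 4) * a ^ (m * j)  <⟨ exponential-gap b (q * 4) (m * j) (≤-trans a[4q+1]≤j (m≤m+n j (suc j * j))) ⟩
    suc a ^ (m * j)            ≤⟨ ^-monoˡ-≤ (m * j) a<q ⟩
    q ^ (m * j)                ∎

choose : {n : ℕ} (U : Subset n) (t : ℕ) → t ≤ ∣ U ∣ →
  Σ (Fin t → Fin n) λ g → (∀ k → g k ∈ U) × Injective _≡_ _≡_ g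
choose U             zero    _ = (λ ()) , (λ ()) , λ {k} → ⊥-elim (FinP.¬Fin0 k)
choose (inside ∷ U)  (suc t) (s≤s t≤∣U∣) with choose U t t≤∣U∣
... | g , g∈U , g-inj = g′ , g′∈U , g′-inj
  where
  g′ : Fin (suc t) → Fin _
  g′ zero    = zero
  g′ (suc k) = suc (g k)
  g′∈U : ∀ k → g′ k ∈ inside ∷ U
  g′∈U zero    = here
  g′∈U (suc k) = there (g∈U k)
  g′-inj : Injective _≡_ _≡_ g′
  g′-inj {zero}  {zero}  _  = refl
  g′-inj {suc k} {suc l} eq = cong suc (g-inj (FinP.suc-injective eq))
choose (outside ∷ U) (suc t) t<∣U∣ with choose U (suc t) t<∣U∣
... | g , g∈U , g-inj = suc ∘ g , there ∘ g∈U , g-inj ∘ FinP.suc-injective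

module UsedColours {N q : ℕ} (φ : PairColoring N q) (S : Subset N) where

  Used : Fin q → Set
  Used col = ∃ λ u → ∃ λ v → u ∈ S × v ∈ S × u F.< v × φ u v ≡ col

  used? : (col : Fin q) → Dec (Used col)
  used? col = FinP.any? λ u → FinP.any? λ v →
    (u ∈? S) ×-dec (v ∈? S) ×-dec (u FinP.<? v) ×-dec (φ u v FinP.≟ col)

  usedColours : Subset q
  usedColours = tabulate (does ∘ used?)

  used⇒∈ : ∀ {col} → Used col → col ∈ usedColours
  used⇒∈ {col} used = lookup⇒[]= col usedColours
    (trans (lookup∘tabulate (does ∘ used?) col) (dec-true (used? col) used))

  ∈⇒used : ∀ {col} → col ∈ usedColours → Used col
  ∈⇒used {col} col∈ = toWitness {a? = used? col}
    (subst T (sym (trans (isYes≗does (used? col))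
                        (trans (sym (lookup∘tabulate (does ∘ used?) col)) ([]=⇒lookup col∈)))) tt)

  many-colours : (t : ℕ) → t ≤ ∣ usedColours ∣ → HasManyColors φ S t
  many-colours t t≤∣used∣ = pair , (λ k → u∈S k , v∈S k , u<v k) , colour-inj
    where
    chosen = choose usedColours t t≤∣used∣
    colour : Fin t → Fin q
    colour = proj₁ chosen
    witness : ∀ k → Used (colour k)
    witness k = ∈⇒used (proj₁ (proj₂ chosen) k)
    pair : Fin t → Fin N × Fin N
    pair k = proj₁ (witness k) , proj₁ (proj₂ (witness k))
    u∈S : ∀ k → proj₁ (pair k) ∈ S
    u∈S k = proj₁ (proj₂ (proj₂ (witness k)))
    v∈S : ∀ k → proj₂ (pair k) ∈ S
    v∈S k = proj₁ (proj₂ (proj₂ (proj₂ (witness k))))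
    u<v : ∀ k → proj₁ (pair k) F.< proj₂ (pair k)
    u<v k = proj₁ (proj₂ (proj₂ (proj₂ (proj₂ (witness k)))))
    has-colour : ∀ k → φ (proj₁ (pair k)) (proj₂ (pair k)) ≡ colour k
    has-colour k = proj₂ (proj₂ (proj₂ (proj₂ (proj₂ (witness k)))))
    colour-inj : Injective _≡_ _≡_ (λ k → φ (proj₁ (pair k)) (proj₂ (pair k)))
    colour-inj {k} {l} eq = proj₂ (proj₂ chosen) (trans (sym (has-colour k)) (trans eq (has-colour l)))

module FirstMoment (q a m : ℕ) where
  open Colourings q

  bad : {N : ℕ} → TriColouring N → ℕ
  bad {N} c = ∑[ S ∈ subsets N ] 𝟙 (∣ S ∣ ≡ᵇ m) * (∑[ T ∈ subsets q ] 𝟙 (∣ T ∣ ≤ᵇ a) * confined S T c)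

  confinements : {N : ℕ} → Subset N → ℕ
  confinements {N} S = ∑[ T ∈ subsets q ] 𝟙 (∣ T ∣ ≤ᵇ a) * (∑[ c ∈ colourings N ] confined S T c)

  ∑-bad : (N : ℕ) → ∑[ c ∈ colourings N ] bad c ≡ ∑[ S ∈ subsets N ] 𝟙 (∣ S ∣ ≡ᵇ m) * confinements S
  ∑-bad N = trans (∑-swap (colourings N) (subsets N) _) (∑-cong (subsets N) λ S → begin
    ∑[ c ∈ colourings N ] 𝟙 (∣ S ∣ ≡ᵇ m) * (∑[ T ∈ subsets q ] 𝟙 (∣ T ∣ ≤ᵇ a) * confined S T c)
      ≡⟨ ∑-*ˡ (colourings N) (𝟙 (∣ S ∣ ≡ᵇ m)) _ ⟩
    𝟙 (∣ S ∣ ≡ᵇ m) * (∑[ c ∈ colourings N ] ∑[ T ∈ subsets q ] 𝟙 (∣ T ∣ ≤ᵇ a) * confined S T c)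
      ≡⟨ cong (𝟙 (∣ S ∣ ≡ᵇ m) *_) (trans (∑-swap (colourings N) (subsets q) _)
           (∑-cong (subsets q) λ T → ∑-*ˡ (colourings N) (𝟙 (∣ T ∣ ≤ᵇ a)) (confined S T))) ⟩
    𝟙 (∣ S ∣ ≡ᵇ m) * confinements S ∎)
    where open ≡-Reasoning

  confinements-bound : {N : ℕ} (S : Subset N) → ∣ S ∣ ≡ m →
    q ^ pairs m * confinements S ≤ 2 ^ q * a ^ pairs m * q ^ pairs N
  confinements-bound {N} S ∣S∣≡m = begin
    q ^ pairs m * confinements S
      ≡⟨ sym (∑-*ˡ (subsets q) (q ^ pairs m) _) ⟩
    ∑[ T ∈ subsets q ] q ^ pairs m * (𝟙 (∣ T ∣ ≤ᵇ a) * confinedBy T)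
      ≤⟨ ∑-mono (subsets q) per-T ⟩
    ∑[ T ∈ subsets q ] a ^ pairs m * q ^ pairs N
      ≡⟨ ∑-const (subsets q) (a ^ pairs m * q ^ pairs N) ⟩
    a ^ pairs m * q ^ pairs N * (∑[ T ∈ subsets q ] 1)
      ≡⟨ cong (a ^ pairs m * q ^ pairs N *_) (#vectors sides q) ⟩
    a ^ pairs m * q ^ pairs N * 2 ^ q
      ≡⟨ rearrange (a ^ pairs m) (q ^ pairs N) (2 ^ q) ⟩
    2 ^ q * a ^ pairs m * q ^ pairs N ∎
    where
    open ≤-Reasoning
    confinedBy : Subset q → ℕ
    confinedBy T = ∑[ c ∈ colourings N ] confined S T c
    inner≡ : innerPairs S ≡ pairs m
    inner≡ = trans (innerPairs≡pairs S) (cong pairs ∣S∣≡m)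
    per-T : ∀ T → q ^ pairs m * (𝟙 (∣ T ∣ ≤ᵇ a) * confinedBy T) ≤ a ^ pairs m * q ^ pairs N
    per-T T = begin
      q ^ pairs m * (𝟙 (∣ T ∣ ≤ᵇ a) * confinedBy T) ≡⟨ *-left-comm (q ^ pairs m) (𝟙 (∣ T ∣ ≤ᵇ a)) (confinedBy T) ⟩
      𝟙 (∣ T ∣ ≤ᵇ a) * (q ^ pairs m * confinedBy T)
        ≤⟨ 𝟙-guard (∣ T ∣ ≤ᵇ a) (λ ∣T∣≤a → begin
          q ^ pairs m * confinedBy T ≡⟨ subst (λ e → q ^ e * confinedBy T ≡ ∣ T ∣ ^ e * q ^ pairs N)
                                             inner≡ (#confined-scaled S T) ⟩
          ∣ T ∣ ^ pairs m * q ^ pairs N ≤⟨ *-monoˡ-≤ (q ^ pairs N) (^-monoˡ-≤ (pairs m) (≤ᵇ⇒≤ ∣ T ∣ a ∣T∣≤a)) ⟩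
          a ^ pairs m * q ^ pairs N ∎) ⟩
      𝟙 (∣ T ∣ ≤ᵇ a) * (a ^ pairs m * q ^ pairs N) ≤⟨ 𝟙-≤ (∣ T ∣ ≤ᵇ a) _ ⟩
      a ^ pairs m * q ^ pairs N ∎
    rearrange : ∀ x y z → x * y * z ≡ z * x * y
    rearrange = solve-∀

  good-colouring : .{{_ : NonZero q}} (N : ℕ) → N ^ m * 2 ^ q * a ^ pairs m < q ^ pairs m →
    ∃ λ (c : TriColouring N) → bad c < 1
  good-colouring N key = ∑-<-witness (colourings N) bad (λ _ → 1)
    (subst (∑[ c ∈ colourings N ] bad c <_) (sym (#colourings N))
      (*-cancelˡ-< (q ^ pairs m) _ _ (begin-strict
        q ^ pairs m * (∑[ c ∈ colourings N ] bad c)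
          ≡⟨ cong (q ^ pairs m *_) (∑-bad N) ⟩
        q ^ pairs m * (∑[ S ∈ subsets N ] 𝟙 (∣ S ∣ ≡ᵇ m) * confinements S)
          ≡⟨ sym (∑-*ˡ (subsets N) (q ^ pairs m) _) ⟩
        ∑[ S ∈ subsets N ] q ^ pairs m * (𝟙 (∣ S ∣ ≡ᵇ m) * confinements S)
          ≤⟨ ∑-mono (subsets N) per-S ⟩
        ∑[ S ∈ subsets N ] 𝟙 (∣ S ∣ ≡ᵇ m) * K
          ≡⟨ ∑-cong (subsets N) (λ S → *-comm (𝟙 (∣ S ∣ ≡ᵇ m)) K) ⟩
        ∑[ S ∈ subsets N ] K * 𝟙 (∣ S ∣ ≡ᵇ m)
          ≡⟨ ∑-*ˡ (subsets N) K _ ⟩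
        K * (∑[ S ∈ subsets N ] 𝟙 (∣ S ∣ ≡ᵇ m))
          ≤⟨ *-monoʳ-≤ K (#subsets-of-size N m) ⟩
        K * N ^ m
          ≡⟨ rearrange (2 ^ q) (a ^ pairs m) (q ^ pairs N) (N ^ m) ⟩
        N ^ m * 2 ^ q * a ^ pairs m * q ^ pairs N
          <⟨ *-monoˡ-< (q ^ pairs N) {{qᴰ≢0}} key ⟩
        q ^ pairs m * q ^ pairs N ∎)))
    where
    open ≤-Reasoning
    K = 2 ^ q * a ^ pairs m * q ^ pairs N
    qᴰ≢0 : NonZero (q ^ pairs N)
    qᴰ≢0 = >-nonZero (m^n>0 q (pairs N))
    per-S : ∀ S → q ^ pairs m * (𝟙 (∣ S ∣ ≡ᵇ m) * confinements S) ≤ 𝟙 (∣ S ∣ ≡ᵇ m) * K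
    per-S S = ≤-trans (≤-reflexive (*-left-comm (q ^ pairs m) (𝟙 (∣ S ∣ ≡ᵇ m)) (confinements S)))
      (𝟙-guard (∣ S ∣ ≡ᵇ m) (λ ∣S∣≡m → confinements-bound S (≡ᵇ⇒≡ ∣ S ∣ m ∣S∣≡m)))
    rearrange : ∀ x y z w → x * y * z * w ≡ w * x * y * z
    rearrange = solve-∀

  no-bad⇒many-colours : (d : Fin q) {N : ℕ} (c : TriColouring N) → bad c < 1 →
    (S : Subset N) → ∣ S ∣ ≡ m → HasManyColors (decode d c) S (suc a)
  no-bad⇒many-colours d {N} c bad<1 S ∣S∣≡m = many-colours (suc a) (≰⇒> few-colours-impossible)
    where
    open UsedColours (decode d c) S
    S-confined : confined S usedColours c ≡ 1
    S-confined = decode-confined d S usedColours c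
      (λ u v u∈S v∈S u<v → used⇒∈ (u , v , u∈S , v∈S , u<v , refl))
    few-colours-impossible : ¬ (∣ usedColours ∣ ≤ a)
    few-colours-impossible ∣used∣≤a = <⇒≱ bad<1 (begin
      1 ≡⟨ sym (cong₂ _*_ (𝟙-true (≡⇒≡ᵇ ∣ S ∣ m ∣S∣≡m))
                          (cong₂ _*_ (𝟙-true (≤⇒≤ᵇ ∣used∣≤a)) S-confined)) ⟩
      𝟙 (∣ S ∣ ≡ᵇ m) * (𝟙 (∣ usedColours ∣ ≤ᵇ a) * confined S usedColours c)
        ≤⟨ *-monoʳ-≤ (𝟙 (∣ S ∣ ≡ᵇ m))
             (∑-member (λ T → 𝟙 (∣ T ∣ ≤ᵇ a) * confined S T c) (subsets-complete usedColours)) ⟩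
      𝟙 (∣ S ∣ ≡ᵇ m) * (∑[ T ∈ subsets q ] 𝟙 (∣ T ∣ ≤ᵇ a) * confined S T c)
        ≤⟨ ∑-member (λ S → 𝟙 (∣ S ∣ ≡ᵇ m) * (∑[ T ∈ subsets q ] 𝟙 (∣ T ∣ ≤ᵇ a) * confined S T c))
                    (subsets-complete S) ⟩
      bad c ∎)
      where open ≤-Reasoning

lemma2p1 : (q t : ℕ) → 2 ≤ t → t ≤ q →
    ∃ λ m₀ → (m : ℕ) → m₀ ≤ m → (N : ℕ) → IsFloorRoot q t m N →
      Σ (PairColoring N q) λ φ → (S : Subset N) → ∣ S ∣ ≡ m → HasManyColors φ S t
lemma2p1 zero     (suc (suc b)) _               ()
lemma2p1 (suc q′) (suc (suc b)) (s≤s (s≤s z≤n)) t≤q = 2 + suc b * suc (q * 4) , large-m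
  where
  -- With a = t - 1 = suc b, any m = 2 + j with j ≥ a(4q+1) works.
  q = suc q′
  large-m : (m : ℕ) → 2 + suc b * suc (q * 4) ≤ m → (N : ℕ) → IsFloorRoot q (2 + b) m N →
    Σ (PairColoring N q) λ φ → (S : Subset N) → ∣ S ∣ ≡ m → HasManyColors φ S (2 + b)
  large-m (suc (suc j)) (s≤s (s≤s a[4q+1]≤j)) N (N⁴aᵐ≤qᵐ , _) =
    let open FirstMoment q (suc b) (2 + j)
        (c , no-bad) = good-colouring N (key-inequality N b q j N⁴aᵐ≤qᵐ t≤q a[4q+1]≤j)
    in Colourings.decode q zero c , no-bad⇒many-colours zero c no-bad
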